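{- Let $p$ be a finite binary word of length $m$ with $p[1]=1$, and let $k$ be the number of runs in $p$. Any sequence of masque operations of length $m$, each of type $A$ or of type $B$, whose successive application transforms $p$ into $0^m$ consists of at least $\lfloor k/3\rfloor$ operations.
   Context: A run in a word is a maximal block of equal consecutive letters. For $0\le t\le m$, the masque of type $A$ is $M^A_m(t)=0^t1^{m-t}$. For integers $t\ge1$, $s\ge2$ with $t+s\le m$, the masque of type $B$ is $M^B_m(t,s)=0^{t-1}\,1\,1^{s-1}\,0\,1^{m-t-s}$. A masque $M$ of length $m$ defines a masque operation on $\{0,1\}^m$ sending $q$ to the word whose $i$-th letter is $q[i]$ if $M[i]=0$ and $1-q[i]$ if $M[i]=1$. -}

module Defs where

open import Data.Bool using (Bool; true; false; _xor_; if_then_else_)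
open import Data.Nat using (ℕ; zero; suc; _+_; _∸_; _≤_)
open import Data.List using (List; []; _∷_; _++_; replicate; zipWith; foldl)

-- Binary words: lists of Bool, with false = letter 0 and true = letter 1.
Word : Set
Word = List Bool

runs : Word → ℕ
runs [] = 0
runs (x ∷ []) = 1
runs (x ∷ y ∷ xs) = (if x xor y then 1 else 0) + runs (y ∷ xs)

masqueA : ℕ → ℕ → Word
masqueA m t = replicate t false ++ replicate (m ∸ t) true

masqueB : ℕ → ℕ → ℕ → Word
masqueB m t s =
  replicate (t ∸ 1) false ++ (true ∷ []) ++ replicate (s ∸ 1) true
    ++ (false ∷ []) ++ replicate (m ∸ t ∸ s) true

data IsMasque (m : ℕ) : Word → Set where
  typeA : (t : ℕ) → t ≤ m → IsMasque m (masqueA m t)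
  typeB : (t s : ℕ) → 1 ≤ t → 2 ≤ s → t + s ≤ m → IsMasque m (masqueB m t s)

applyMasque : Word → Word → Word
applyMasque q M = zipWith _xor_ q M

applyAll : Word → List Word → Word
applyAll q Ms = foldl applyMasque q Ms

module Submission where

-- A word with k runs has k − 1 changes, i.e. positions i with q[i] ≠ q[i+1].
-- Letterwise xor is at worst additive on changes, and every masque of type A or B
-- has at most 3 changes. Undoing a masque is applying it again, so each operation
-- lowers the number of changes by at most 3; reaching 0^m, which has none, from p
-- therefore takes at least (k − 1)/3 operations.

open import Defs
open import Algebra.Bundles using (CommutativeRing)
open import Data.Bool using (Bool; true; false; _xor_)
open import Data.Bool.Properties
  using (xor-assoc; xor-same; xor-identityʳ; xor-∧-commutativeRing)
open import Data.Nat using (ℕ; zero; suc; _+_; _*_; _∸_; _⊓_; _≤_; _<_; _/_; z≤n; s≤s)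
open import Data.Nat.Properties
open import Data.Nat.DivMod using (m<n*o⇒m/o<n)
open import Data.List using (List; []; _∷_; _++_; length; replicate; zipWith)
open import Data.List.Properties using (length-++; length-replicate; length-zipWith)
open import Data.List.Relation.Unary.All using (All; []; _∷_)
open import Relation.Binary.PropositionalEquality

open import Algebra.Properties.CommutativeSemigroup
  (CommutativeRing.+-commutativeSemigroup xor-∧-commutativeRing)
  using () renaming (interchange to xor-interchange)
open import Algebra.Properties.CommutativeSemigroup +-commutativeSemigroup
  using () renaming (interchange to +-interchange)

toℕ : Bool → ℕ
toℕ false = 0
toℕ true = 1

toℕ-xor-≤ : ∀ u v → toℕ (u xor v) ≤ toℕ u + toℕ v
toℕ-xor-≤ false v = ≤-refl
toℕ-xor-≤ true false = ≤-refl
toℕ-xor-≤ true true = z≤n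

changes : Word → ℕ
changes [] = 0
changes (x ∷ []) = 0
changes (x ∷ y ∷ xs) = toℕ (x xor y) + changes (y ∷ xs)

runs≡1+changes : ∀ x xs → runs (x ∷ xs) ≡ suc (changes (x ∷ xs))
runs≡1+changes x [] = refl
runs≡1+changes x (y ∷ xs) with x xor y
... | false = runs≡1+changes y xs
... | true = cong suc (runs≡1+changes y xs)

changes-zipWith-xor : ∀ q M → changes (zipWith _xor_ q M) ≤ changes q + changes M
changes-zipWith-xor [] M = z≤n
changes-zipWith-xor (x ∷ []) [] = z≤n
changes-zipWith-xor (x ∷ []) (a ∷ M) = z≤n
changes-zipWith-xor (x ∷ y ∷ q) [] = z≤n
changes-zipWith-xor (x ∷ y ∷ q) (a ∷ []) = z≤n
changes-zipWith-xor (x ∷ y ∷ q) (a ∷ b ∷ M) = begin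
    toℕ ((x xor a) xor (y xor b)) + changes (zipWith _xor_ (y ∷ q) (b ∷ M))
  ≡⟨ cong (λ c → toℕ c + _) (xor-interchange x a y b) ⟩
    toℕ ((x xor y) xor (a xor b)) + changes (zipWith _xor_ (y ∷ q) (b ∷ M))
  ≤⟨ +-mono-≤ (toℕ-xor-≤ (x xor y) (a xor b)) (changes-zipWith-xor (y ∷ q) (b ∷ M)) ⟩
    (toℕ (x xor y) + toℕ (a xor b)) + (changes (y ∷ q) + changes (b ∷ M))
  ≡⟨ +-interchange (toℕ (x xor y)) _ _ _ ⟩
    (toℕ (x xor y) + changes (y ∷ q)) + (toℕ (a xor b) + changes (b ∷ M))
  ∎
  where open ≤-Reasoning

xor-cancelʳ : ∀ x a → (x xor a) xor a ≡ x
xor-cancelʳ x a = begin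
  (x xor a) xor a  ≡⟨ xor-assoc x a a ⟩
  x xor (a xor a)  ≡⟨ cong (x xor_) (xor-same a) ⟩
  x xor false      ≡⟨ xor-identityʳ x ⟩
  x                ∎
  where open ≡-Reasoning

applyMasque-involutive : ∀ q M → length q ≤ length M → applyMasque (applyMasque q M) M ≡ q
applyMasque-involutive [] M _ = refl
applyMasque-involutive (x ∷ q) (a ∷ M) (s≤s q≤M) =
  cong₂ _∷_ (xor-cancelʳ x a) (applyMasque-involutive q M q≤M)

changes-≤-applyMasque : ∀ q M → length q ≤ length M →
  changes q ≤ changes (applyMasque q M) + changes M
changes-≤-applyMasque q M q≤M = begin
  changes q                                   ≡⟨ cong changes (applyMasque-involutive q M q≤M) ⟨
  changes (applyMasque (applyMasque q M) M)   ≤⟨ changes-zipWith-xor (applyMasque q M) M ⟩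
  changes (applyMasque q M) + changes M       ∎
  where open ≤-Reasoning

changes-replicate : ∀ n x → changes (replicate n x) ≡ 0
changes-replicate zero x = refl
changes-replicate (suc zero) x = refl
changes-replicate (suc (suc n)) false = changes-replicate (suc n) false
changes-replicate (suc (suc n)) true = changes-replicate (suc n) true

changes-∷ : ∀ x ys → changes (x ∷ ys) ≤ 1 + changes ys
changes-∷ x [] = z≤n
changes-∷ x (y ∷ ys) = +-monoˡ-≤ (changes (y ∷ ys)) (toℕ≤1 (x xor y))
  where
  toℕ≤1 : ∀ b → toℕ b ≤ 1
  toℕ≤1 false = z≤n
  toℕ≤1 true = ≤-refl

changes-++ : ∀ xs ys → changes (xs ++ ys) ≤ changes xs + 1 + changes ys
changes-++ [] ys = n≤1+n (changes ys)
changes-++ (x ∷ []) ys = changes-∷ x ys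
changes-++ (x ∷ y ∷ xs) ys = begin
  toℕ (x xor y) + changes (y ∷ xs ++ ys)              ≤⟨ +-monoʳ-≤ (toℕ (x xor y)) (changes-++ (y ∷ xs) ys) ⟩
  toℕ (x xor y) + (changes (y ∷ xs) + 1 + changes ys) ≡⟨ +-assoc (toℕ (x xor y)) _ _ ⟨
  toℕ (x xor y) + (changes (y ∷ xs) + 1) + changes ys ≡⟨ cong (_+ changes ys) (+-assoc (toℕ (x xor y)) _ _) ⟨
  toℕ (x xor y) + changes (y ∷ xs) + 1 + changes ys   ∎
  where open ≤-Reasoning

changes-replicate-++ : ∀ n x ys → changes (replicate n x ++ ys) ≤ 1 + changes ys
changes-replicate-++ n x ys = begin
  changes (replicate n x ++ ys)                 ≤⟨ changes-++ (replicate n x) ys ⟩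
  changes (replicate n x) + 1 + changes ys      ≡⟨ cong (λ c → c + 1 + changes ys) (changes-replicate n x) ⟩
  1 + changes ys                                ∎
  where open ≤-Reasoning

changes-masque : ∀ {m M} → IsMasque m M → changes M ≤ 3
changes-masque {m} (typeA t _) = begin
  changes (replicate t false ++ replicate (m ∸ t) true) ≤⟨ changes-replicate-++ t false _ ⟩
  1 + changes (replicate (m ∸ t) true)                  ≡⟨ cong suc (changes-replicate (m ∸ t) true) ⟩
  1                                                     ≤⟨ s≤s z≤n ⟩
  3                                                     ∎
  where open ≤-Reasoning
changes-masque {m} (typeB t s _ _ _) = begin
  changes (replicate (t ∸ 1) false ++ replicate (suc (s ∸ 1)) true ++ tail)
    ≤⟨ changes-replicate-++ (t ∸ 1) false _ ⟩
  1 + changes (replicate (suc (s ∸ 1)) true ++ tail)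
    ≤⟨ s≤s (changes-replicate-++ (suc (s ∸ 1)) true tail) ⟩
  2 + changes tail
    ≤⟨ s≤s (s≤s (changes-∷ false (replicate (m ∸ t ∸ s) true))) ⟩
  3 + changes (replicate (m ∸ t ∸ s) true)
    ≡⟨ cong (3 +_) (changes-replicate (m ∸ t ∸ s) true) ⟩
  3 ∎
  where
  open ≤-Reasoning
  tail : Word
  tail = false ∷ replicate (m ∸ t ∸ s) true

length-masque : ∀ {m M} → IsMasque m M → length M ≡ m
length-masque {m} (typeA t t≤m) = begin
  length (replicate t false ++ replicate (m ∸ t) true) ≡⟨ length-++ (replicate t false) ⟩
  length (replicate t false) + length (replicate (m ∸ t) true)
    ≡⟨ cong₂ _+_ (length-replicate t) (length-replicate (m ∸ t)) ⟩
  t + (m ∸ t)                                          ≡⟨ m+[n∸m]≡n t≤m ⟩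
  m                                                    ∎
  where open ≡-Reasoning
length-masque (typeB (suc t) (suc zero) _ (s≤s ()) _)
length-masque {m} (typeB (suc t) (suc (suc s)) _ _ t+s≤m) = begin
  length (replicate t false ++ replicate (2 + s) true ++ false ∷ replicate r true)
    ≡⟨ length-++ (replicate t false) ⟩
  length (replicate t false) + length (replicate (2 + s) true ++ false ∷ replicate r true)
    ≡⟨ cong (length (replicate t false) +_) (length-++ (replicate (2 + s) true)) ⟩
  length (replicate t false) + (length (replicate (2 + s) true) + suc (length (replicate r true)))
    ≡⟨ cong₂ (λ a b → a + (b + suc (length (replicate r true))))
             (length-replicate t) (length-replicate (2 + s)) ⟩
  t + (2 + s + suc (length (replicate r true)))
    ≡⟨ cong (λ c → t + (2 + s + suc c)) (trans (length-replicate r) (∸-+-assoc m (1 + t) (2 + s))) ⟩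
  t + (2 + s + suc (m ∸ (1 + t + (2 + s))))
    ≡⟨ shift t (2 + s) (m ∸ (1 + t + (2 + s))) ⟩
  1 + t + (2 + s) + (m ∸ (1 + t + (2 + s)))
    ≡⟨ m+[n∸m]≡n t+s≤m ⟩
  m ∎
  where
  open ≡-Reasoning
  r : ℕ
  r = m ∸ suc t ∸ suc (suc s)
  shift : ∀ a b c → a + (b + suc c) ≡ suc a + b + c
  shift a b c = begin
    a + (b + suc c)   ≡⟨ cong (a +_) (+-suc b c) ⟩
    a + suc (b + c)   ≡⟨ +-suc a (b + c) ⟩
    suc (a + (b + c)) ≡⟨ cong suc (+-assoc a b c) ⟨
    suc a + b + c     ∎

changes-≤-applyAll : ∀ m q → length q ≡ m → (Ms : List Word) → All (IsMasque m) Ms →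
  changes q ≤ changes (applyAll q Ms) + length Ms * 3
changes-≤-applyAll m q _ [] [] = m≤m+n (changes q) 0
changes-≤-applyAll m q lq (M ∷ Ms) (isM ∷ areMs) = begin
  changes q
    ≤⟨ changes-≤-applyMasque q M (≤-reflexive lq≡lM) ⟩
  changes q′ + changes M
    ≤⟨ +-mono-≤ (changes-≤-applyAll m q′ lq′ Ms areMs) (changes-masque isM) ⟩
  changes (applyAll q′ Ms) + length Ms * 3 + 3
    ≡⟨ +-assoc (changes (applyAll q′ Ms)) _ 3 ⟩
  changes (applyAll q′ Ms) + (length Ms * 3 + 3)
    ≡⟨ cong (changes (applyAll q′ Ms) +_) (+-comm (length Ms * 3) 3) ⟩
  changes (applyAll q′ Ms) + (3 + length Ms * 3)
    ∎
  where
  open ≤-Reasoning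
  lq≡lM : length q ≡ length M
  lq≡lM = trans lq (sym (length-masque isM))
  q′ : Word
  q′ = applyMasque q M
  lq′ : length q′ ≡ m
  lq′ = trans (length-zipWith _xor_ q M) (trans (cong₂ _⊓_ lq (length-masque isM)) (⊓-idem m))

corollary1 : (m : ℕ) (w : Word) → length (true ∷ w) ≡ m →
    (Ms : List Word) → All (IsMasque m) Ms → applyAll (true ∷ w) Ms ≡ replicate m false →
    runs (true ∷ w) / 3 ≤ length Ms
corollary1 m w lp Ms areMs reachesZero = ≤-pred (m<n*o⇒m/o<n runs<[1+n]*3)
  where
  open ≤-Reasoning
  n : ℕ
  n = length Ms
  runs<[1+n]*3 : runs (true ∷ w) < suc n * 3
  runs<[1+n]*3 = begin-strict
    runs (true ∷ w)                                        ≡⟨ runs≡1+changes true w ⟩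
    suc (changes (true ∷ w))                               ≤⟨ s≤s (changes-≤-applyAll m (true ∷ w) lp Ms areMs) ⟩
    suc (changes (applyAll (true ∷ w) Ms) + n * 3)         ≡⟨ cong (λ q → suc (changes q + n * 3)) reachesZero ⟩
    suc (changes (replicate m false) + n * 3)              ≡⟨ cong (λ c → suc (c + n * 3)) (changes-replicate m false) ⟩
    suc (n * 3)                                            <⟨ s≤s (s≤s (n≤1+n (n * 3))) ⟩
    suc n * 3                                              ∎
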